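{- Let $n\ge1$, $b\in\mathrm{PF}_\le(n)$, $w\in\mathfrak S_n$, and $A\subseteq\mathrm{Des}(\sigma^{b,w})$. Then $\Phi(w,A)=\{(\sigma^{b,w}(i+1),w(i)):i\in A\}$ is a placement of $|A|$ nonattacking rooks on the board $B_b$.
   Context: A parking content is a sequence $b=(b_1,\dots,b_n)$ of positive integers with $b_1\le\dots\le b_n$ and $b_j\le j$; $\mathrm{PF}_\le(n)$ is the set of these. For $w\in\mathfrak S_n$, $\pi^{b,w}$ has $\pi^{b,w}_i=b_{w(i)}$. Parking procedure: cars $1,\dots,n$ arrive in order at spots $1,\dots,n$; car $i$ goes to spot $\pi_i$ and, if occupied, moves forward to the next unoccupied spot; $\mathrm{oc}(\pi)$ is the permutation $\sigma$ with car $i$ parking in spot $\sigma(i)$, and $\sigma^{b,w}=\mathrm{oc}(\pi^{b,w})$. $\mathrm{Des}(\sigma)=\{i\in[n-1]:\sigma(i)>\sigma(i+1)\}$. $B_b$ is the board of cells $(r,c)\in[n]\times[n]$ (row $r$, column $c$) with $r<b_c$; rooks are nonattacking if no two share a row or column. -}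

module Defs where

open import Data.Nat using (ℕ; zero; suc; _≤_; _<_; _+_)
open import Data.Nat.Properties using (_≟_)
open import Data.Fin using (Fin; toℕ; inject₁) renaming (suc to fsuc)
open import Data.Fin.Permutation using (Permutation′; _⟨$⟩ʳ_)
open import Data.List using (List; []; _∷_; length)
open import Data.List.Membership.DecPropositional _≟_ using (_∈?_)
open import Data.Vec using (Vec; []; _∷_; lookup; tabulate)
open import Data.Product using (_×_)
open import Relation.Nullary using (yes; no)

-- Indices are 0-based elements of Fin n (index i : Fin n stands for i+1 ∈ [n]);
-- values of b, preferences and spots are 1-based natural numbers, as in the paper.

record IsParkingContent (n : ℕ) (b : Fin n → ℕ) : Set where
  field
    positive : ∀ j → 1 ≤ b j
    bounded  : ∀ j → b j ≤ toℕ j + 1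
    weaklyIncreasing : ∀ i j → toℕ i ≤ toℕ j → b i ≤ b j

πbw : ∀ {n} → (Fin n → ℕ) → Permutation′ n → Fin n → ℕ
πbw b w i = b (w ⟨$⟩ʳ i)

-- first unoccupied spot ≥ p (fuel = number of occupied spots suffices)
firstFree : ℕ → List ℕ → ℕ → ℕ
firstFree zero    occ p = p
firstFree (suc f) occ p with p ∈? occ
... | yes _ = firstFree f occ (suc p)
... | no  _ = p

parkAll : ∀ {k} → List ℕ → Vec ℕ k → Vec ℕ k
parkAll occ [] = []
parkAll occ (p ∷ ps) = s ∷ parkAll (s ∷ occ) ps
  where s = firstFree (length occ) occ p

-- oc(π): car i parks in spot oc π i (1-based spot)
oc : ∀ {n} → (Fin n → ℕ) → Fin n → ℕ
oc π = lookup (parkAll [] (tabulate π))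

σbw : ∀ {n} → (Fin n → ℕ) → Permutation′ n → Fin n → ℕ
σbw b w = oc (πbw b w)

-- For n = suc m, positions i ∈ [n-1] are Fin m; position i (0-based) has
-- i ↦ inject₁ i and i+1 ↦ fsuc i in Fin n.
-- i ∈ Des(σ)  iff  σ(i) > σ(i+1)
IsDescent : ∀ {m} → (Fin (suc m) → ℕ) → Fin m → Set
IsDescent σ i = σ (fsuc i) < σ (inject₁ i)

-- Board B_b: cells (r,c) ∈ [n]×[n] with r < b_c.  Row r is 1-based ℕ,
-- column c : Fin n stands for column toℕ c + 1.
InBoard : ∀ {n} → (Fin n → ℕ) → ℕ → Fin n → Set
InBoard {n} b r c = (1 ≤ r × r ≤ n) × r < b c

module Submission where

open import Defs
open import Data.Nat using (ℕ; suc; zero; _≤_; _<_; z≤n; s≤s; s≤s⁻¹; _≤?_)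
open import Data.Nat.Properties
  using (_≟_; ≤-refl; ≤-trans; <⇒≤; ≤-<-trans; <-≤-trans; ≤∧≢⇒<; m≤n⇒m≤1+n; n≤1+n; <-irrefl; +-comm)
open import Data.Fin using (Fin; inject₁) renaming (suc to fsuc; zero to fzero)
open import Data.Fin.Properties using (suc-injective; inject₁-injective; toℕ<n)
open import Data.Fin.Subset using (Subset; _∈_)
open import Data.Fin.Permutation using (Permutation′; _⟨$⟩ʳ_)
open import Data.Product using (_×_; _,_)
open import Data.List using (List; []; _∷_; length)
open import Data.List.Relation.Unary.Any using (here; there)
open import Data.List.Membership.Propositional using () renaming (_∈_ to _∈ₗ_; _∉_ to _∉ₗ_)
open import Data.List.Membership.DecPropositional _≟_ using (_∈?_)
open import Data.Vec using (Vec; _∷_; lookup; tabulate)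
open import Data.Vec.Properties using (lookup∘tabulate)
open import Function.Bundles using (Injection)
open import Function.Properties.Inverse using (↔⇒↣)
open import Relation.Binary.PropositionalEquality using (_≡_; refl; sym; cong; subst)
open import Relation.Nullary using (¬_; yes; no; contradiction)

-- Idea: a car parks at the first free spot at or after its preference, so every
-- spot strictly between its preference and its own spot was already occupied.
-- At a descent i, car i+1 takes a spot below car i's spot; that spot was free
-- when car i arrived, hence it lies below car i's preference b_{w(i)}.  This
-- places the rook in the board; rows and columns are distinct because the
-- outcome map and w are injective.  The fuel bound in firstFree is never hit:
-- each skipped spot removes one occupied spot ≥ the current position.

countFrom : ℕ → List ℕ → ℕ
countFrom p [] = 0
countFrom p (x ∷ xs) with p ≤? x
... | yes _ = suc (countFrom p xs)
... | no  _ = countFrom p xs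

countFrom≤length : ∀ p xs → countFrom p xs ≤ length xs
countFrom≤length p [] = z≤n
countFrom≤length p (x ∷ xs) with p ≤? x
... | yes _ = s≤s (countFrom≤length p xs)
... | no  _ = m≤n⇒m≤1+n (countFrom≤length p xs)

countFrom-suc≤ : ∀ p xs → countFrom (suc p) xs ≤ countFrom p xs
countFrom-suc≤ p [] = z≤n
countFrom-suc≤ p (x ∷ xs) with suc p ≤? x | p ≤? x
... | yes _   | yes _   = s≤s (countFrom-suc≤ p xs)
... | yes p<x | no  p≰x = contradiction (<⇒≤ p<x) p≰x
... | no  _   | yes _   = m≤n⇒m≤1+n (countFrom-suc≤ p xs)
... | no  _   | no  _   = countFrom-suc≤ p xs

countFrom-suc< : ∀ p xs → p ∈ₗ xs → countFrom (suc p) xs < countFrom p xs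
countFrom-suc< p (x ∷ xs) (here refl) with suc p ≤? p | p ≤? p
... | yes p<p | _       = contradiction p<p (<-irrefl refl)
... | no  _   | yes _   = s≤s (countFrom-suc≤ p xs)
... | no  _   | no  p≰p = contradiction ≤-refl p≰p
countFrom-suc< p (x ∷ xs) (there p∈xs) with suc p ≤? x | p ≤? x
... | yes _   | yes _   = s≤s (countFrom-suc< p xs p∈xs)
... | yes p<x | no  p≰x = contradiction (<⇒≤ p<x) p≰x
... | no  _   | yes _   = m≤n⇒m≤1+n (countFrom-suc< p xs p∈xs)
... | no  _   | no  _   = countFrom-suc< p xs p∈xs

≤-firstFree : ∀ f occ p → p ≤ firstFree f occ p
≤-firstFree zero    occ p = ≤-refl
≤-firstFree (suc f) occ p with p ∈? occ
... | yes _ = ≤-trans (n≤1+n p) (≤-firstFree f occ (suc p))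
... | no  _ = ≤-refl

free-<firstFree⇒<start : ∀ f occ p {q} → q ∉ₗ occ → q < firstFree f occ p → q < p
free-<firstFree⇒<start zero    occ p q∉occ q<p = q<p
free-<firstFree⇒<start (suc f) occ p q∉occ q<ff with p ∈? occ
... | yes p∈occ = ≤∧≢⇒< (s≤s⁻¹ (free-<firstFree⇒<start f occ (suc p) q∉occ q<ff))
                               (λ { refl → q∉occ p∈occ })
... | no  _     = q<ff

firstFree∈⇒fuel<countFrom : ∀ f occ p → firstFree f occ p ∈ₗ occ → f < countFrom p occ
firstFree∈⇒fuel<countFrom zero    occ p p∈occ = ≤-<-trans z≤n (countFrom-suc< p occ p∈occ)
firstFree∈⇒fuel<countFrom (suc f) occ p ff∈occ with p ∈? occ
... | yes p∈occ = <-≤-trans (s≤s (firstFree∈⇒fuel<countFrom f occ (suc p) ff∈occ))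
                            (countFrom-suc< p occ p∈occ)
... | no  p∉occ = contradiction ff∈occ p∉occ

firstFree-free : ∀ occ p → firstFree (length occ) occ p ∉ₗ occ
firstFree-free occ p ff∈occ =
  <-irrefl refl (<-≤-trans (firstFree∈⇒fuel<countFrom (length occ) occ p ff∈occ)
                           (countFrom≤length p occ))

private variable k : ℕ

parkAll-free : ∀ occ (ps : Vec ℕ k) x → lookup (parkAll occ ps) x ∉ₗ occ
parkAll-free occ (p ∷ ps) fzero    = firstFree-free occ p
parkAll-free occ (p ∷ ps) (fsuc x) = λ s∈occ → parkAll-free _ ps x (there s∈occ)

parkAll-injective : ∀ occ (ps : Vec ℕ k) {x y} →
                    lookup (parkAll occ ps) x ≡ lookup (parkAll occ ps) y → x ≡ y
parkAll-injective occ (p ∷ ps) {fzero}  {fzero}  _ = refl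
parkAll-injective occ (p ∷ ps) {fzero}  {fsuc y} e = contradiction (here (sym e)) (parkAll-free _ ps y)
parkAll-injective occ (p ∷ ps) {fsuc x} {fzero}  e = contradiction (here e) (parkAll-free _ ps x)
parkAll-injective occ (p ∷ ps) {fsuc x} {fsuc y} e = cong fsuc (parkAll-injective _ ps e)

lookup≤lookup-parkAll : ∀ occ (ps : Vec ℕ k) x → lookup ps x ≤ lookup (parkAll occ ps) x
lookup≤lookup-parkAll occ (p ∷ ps) fzero    = ≤-firstFree (length occ) occ p
lookup≤lookup-parkAll occ (p ∷ ps) (fsuc x) = lookup≤lookup-parkAll _ ps x

parkAll-descent⇒<preference : ∀ occ (ps : Vec ℕ (suc k)) i →
  lookup (parkAll occ ps) (fsuc i) < lookup (parkAll occ ps) (inject₁ i) →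
  lookup (parkAll occ ps) (fsuc i) < lookup ps (inject₁ i)
parkAll-descent⇒<preference occ (p ∷ p′ ∷ ps) fzero s′<s =
  free-<firstFree⇒<start (length occ) occ p
    (λ s′∈occ → parkAll-free _ (p′ ∷ ps) fzero (there s′∈occ)) s′<s
parkAll-descent⇒<preference occ (p ∷ ps) (fsuc i) d = parkAll-descent⇒<preference _ ps i d

oc-injective : ∀ {n} (π : Fin n → ℕ) {i j} → oc π i ≡ oc π j → i ≡ j
oc-injective π = parkAll-injective [] (tabulate π)

preference≤oc : ∀ {n} (π : Fin n → ℕ) i → π i ≤ oc π i
preference≤oc π i =
  subst (_≤ oc π i) (lookup∘tabulate π i) (lookup≤lookup-parkAll [] (tabulate π) i)

oc-descent⇒<preference : ∀ {m} (π : Fin (suc m) → ℕ) i →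
  IsDescent (oc π) i → oc π (fsuc i) < π (inject₁ i)
oc-descent⇒<preference π i d =
  subst (oc π (fsuc i) <_) (lookup∘tabulate π (inject₁ i))
        (parkAll-descent⇒<preference [] (tabulate π) i d)

lemma3p4 : (m : ℕ) (b : Fin (suc m) → ℕ) → IsParkingContent (suc m) b →
           (w : Permutation′ (suc m)) (A : Subset m) →
           (∀ i → i ∈ A → IsDescent (σbw b w) i) →
           (∀ i → i ∈ A → InBoard b (σbw b w (fsuc i)) (w ⟨$⟩ʳ inject₁ i))
           × (∀ i j → i ∈ A → j ∈ A → ¬ i ≡ j →
                (¬ σbw b w (fsuc i) ≡ σbw b w (fsuc j))
                × (¬ w ⟨$⟩ʳ inject₁ i ≡ w ⟨$⟩ʳ inject₁ j))
lemma3p4 m b pc w A des = inBoard , nonattacking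
  where
  open IsParkingContent pc
  π : Fin (suc m) → ℕ
  π = πbw b w

  inBoard : ∀ i → i ∈ A → InBoard b (σbw b w (fsuc i)) (w ⟨$⟩ʳ inject₁ i)
  inBoard i i∈A = (1≤row , row≤n) , row<b
    where
    row<b : σbw b w (fsuc i) < b (w ⟨$⟩ʳ inject₁ i)
    row<b = oc-descent⇒<preference π i (des i i∈A)
    1≤row : 1 ≤ σbw b w (fsuc i)
    1≤row = ≤-trans (positive (w ⟨$⟩ʳ fsuc i)) (preference≤oc π (fsuc i))
    row≤n : σbw b w (fsuc i) ≤ suc m
    row≤n = ≤-trans (<⇒≤ row<b)
              (≤-trans (bounded (w ⟨$⟩ʳ inject₁ i))
                       (subst (_≤ suc m) (+-comm 1 _) (toℕ<n (w ⟨$⟩ʳ inject₁ i))))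

  nonattacking : ∀ i j → i ∈ A → j ∈ A → ¬ i ≡ j →
                 (¬ σbw b w (fsuc i) ≡ σbw b w (fsuc j)) × (¬ w ⟨$⟩ʳ inject₁ i ≡ w ⟨$⟩ʳ inject₁ j)
  nonattacking i j _ _ i≢j =
    (λ e → i≢j (suc-injective (oc-injective π e))) ,
    (λ e → i≢j (inject₁-injective (Injection.injective (↔⇒↣ w) e)))
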